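{- Let $L(x_1,x_2,x_3,x_4)=x_1+2x_2-x_3-2x_4$. Then the equation $L=0$ is uncommon over the integers; that is, it is not the case that for all sufficiently large $n$ and all functions $f\colon[n]\to[0,1]$ one has $t_L(f)+t_L(1-f)\ge 2^{1-4}=1/8$.
   Context: For $n\in\mathbb{N}$, $[n]=\{1,\dots,n\}$. For a linear form $L(x_1,\dots,x_k)=a_1x_1+\dots+a_kx_k$ with nonzero integer coefficients (at least one positive and one negative) and a function $f\colon[n]\to\mathbb{R}$, let $T_L(f)=\sum_{x_1,\dots,x_k\in[n],\ a_1x_1+\dots+a_kx_k=0} f(x_1)\cdots f(x_k)$ and $t_L(f)=T_L(f)/T_L(1)$, where $1$ denotes the constant function. The equation $L=0$ is called common over the integers if for all sufficiently large $n$ and all $f\colon[n]\to[0,1]$, $t_L(f)+t_L(1-f)\ge 2^{1-k}$; it is uncommon if it is not common. -}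

module Defs where

open import Data.Nat using (ℕ; zero; suc)
open import Data.Fin using (Fin; toℕ)
open import Data.Vec using (Vec; []; _∷_)
open import Data.List using (List; map; allFin)
import Data.Integer as ℤ
open import Data.Integer using (ℤ; +_)
open import Data.Rational using (ℚ; 0ℚ; 1ℚ; _+_; _*_; _-_; _÷_; _≤_; ≢-nonZero; _≟_)
open import Relation.Nullary using (yes; no)

sumℚ : List ℚ → ℚ
sumℚ = Data.List.foldr _+_ 0ℚ

-- The element x ∈ [n] = {1,…,n} is represented by i : Fin n with x = toℕ i + 1.
elem : {n : ℕ} → Fin n → ℤ
elem i = + (suc (toℕ i))

sumTuples : (n k : ℕ) → (Vec (Fin n) k → ℚ) → ℚ
sumTuples n zero    g = g []
sumTuples n (suc k) g = sumℚ (map (λ i → sumTuples n k (λ v → g (i ∷ v))) (allFin n))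

evalForm : {n k : ℕ} → Vec ℤ k → Vec (Fin n) k → ℤ
evalForm []       []       = + 0
evalForm (a ∷ as) (x ∷ xs) = a ℤ.* elem x ℤ.+ evalForm as xs

prodF : {n k : ℕ} → (Fin n → ℚ) → Vec (Fin n) k → ℚ
prodF f []       = 1ℚ
prodF f (x ∷ xs) = f x * prodF f xs

T : {k : ℕ} → Vec ℤ k → (n : ℕ) → (Fin n → ℚ) → ℚ
T {k} a n f = sumTuples n k (λ xs → indicator (evalForm a xs ℤ.≟ + 0) (prodF f xs))
  where
  open import Relation.Nullary using (Dec)
  open import Relation.Binary.PropositionalEquality using (_≡_)
  indicator : {P : Set} → Dec P → ℚ → ℚ
  indicator (yes _) q = q
  indicator (no _)  _ = 0ℚ

-- p / q, with the (never used here) convention p / 0 = 0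
safeDiv : ℚ → ℚ → ℚ
safeDiv p q with q ≟ 0ℚ
... | yes _ = 0ℚ
... | no q≢0 = _÷_ p q {{≢-nonZero q≢0}}

one : {n : ℕ} → Fin n → ℚ
one _ = 1ℚ

t : {k : ℕ} → Vec ℤ k → (n : ℕ) → (Fin n → ℚ) → ℚ
t a n f = safeDiv (T a n f) (T a n one)

L : Vec ℤ 4
L = + 1 ∷ + 2 ∷ ℤ.- (+ 1) ∷ ℤ.- (+ 2) ∷ []

twoPow1-k : ℕ → ℚ
twoPow1-k zero    = 1ℚ + 1ℚ
twoPow1-k (suc k) = go k
  where
  go : ℕ → ℚ
  go zero    = 1ℚ
  go (suc m) = go m * Data.Rational.½

Common : {k : ℕ} → Vec ℤ k → Set
Common {k} a =
  Data.Product.∃ λ (N : ℕ) → (n : ℕ) → N Data.Nat.≤ n →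
    (f : Fin n → ℚ) → ((i : Fin n) → 0ℚ ≤ f i) → ((i : Fin n) → f i ≤ 1ℚ) →
    twoPow1-k k ≤ t a n f + t a n (λ i → 1ℚ - f i)
  where import Data.Product

Uncommon : {k : ℕ} → Vec ℤ k → Set
Uncommon a = Common a → Data.Empty.⊥
  where import Data.Empty

{-# OPTIONS --safe #-}
module Submission where

-- Take n = 2mN with N = 20 and f = ½ + g, where g vanishes except at the points aK
-- (K = 2m, a < N), where it takes prescribed values h_a ∈ [-½, ½]. Expanding
-- T_L(½ + g) + T_L(½ - g), the constant terms give ⅛ T_L(1), the odd terms cancel, and what
-- is left is ½ times six "pair" sums plus twice a quartic sum. Each pair sum is
-- Σ h_a h_b (number of solutions with two coordinates fixed at aK and bK); these counts are
-- m times an explicit piecewise linear function of a and b, up to an error ±1 for the pairs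
-- {1,2} and {3,4}. So the excess over ⅛ T_L(1) is ½ (m α + β) + 2Q, where α, β depend on h
-- only and Q is bounded independently of m. For the h chosen below α < 0, hence the excess
-- is negative once m ≥ 400².

open import Algebra.Bundles using (Ring)
open import Data.Bool using (true; false; if_then_else_)
open import Data.Fin using (Fin; toℕ)
import Data.Fin.Properties as Fin
open import Data.Integer as ℤ using (ℤ)
import Data.Integer.Properties as ℤ
import Data.Integer.Tactic.RingSolver as ℤ-RingSolver
open import Data.List using (List; []; _∷_; map; tabulate)
import Data.List.Properties as List
open import Data.List.Relation.Unary.All using (All; []; _∷_; all?)
open import Data.Nat as ℕ using (ℕ; zero; suc; _⊓_; _∸_; z≤n; s≤s; NonZero)
open import Data.Nat.DivMod using (_/_; m*n/n≡m)
open import Data.Nat.Divisibility using (_∣_; _∣?_; n∣m*n; ∣m+n∣m⇒∣n; ∣⇒≤)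
import Data.Nat.Properties as ℕ
open import Data.Nat.Tactic.RingSolver using (solve-∀)
open import Data.Product using (Σ; _×_; _,_; proj₁; proj₂)
open import Data.Product.Function.NonDependent.Propositional using (_×-⇔_)
open import Data.Rational as ℚ using (ℚ; 0ℚ; 1ℚ; ½; _+_; _*_; _-_; -_; _≤_; _<_; ∣_∣; 1/_)
import Data.Rational.Properties as QP
open import Data.Sum using (inj₁; inj₂)
open import Data.Vec using (Vec; []; _∷_)
open import Function using (_∘_; id; _⇔_; mk⇔; Equivalence)
open import Level using (0ℓ)
open import Relation.Binary.PropositionalEquality
open import Relation.Nullary using (Dec; yes; no; ¬_; does; contradiction)
open import Relation.Nullary.Decidable using (toWitness; _×-dec_; does-⇔; dec-true; dec-false; dec⇒maybe)
import Tactic.RingSolver as RingSolver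
open import Tactic.RingSolver.Core.AlmostCommutativeRing using (AlmostCommutativeRing; fromCommutativeRing)

open import Defs
open import Algebra.Properties.Semiring.Sum (Ring.semiring QP.+-*-ring)
  using (sum; ∑-distrib-+; ∑-comm; *-distribˡ-sum; sum-cong-≗; sum-replicate-zero)
open import Algebra.Properties.Semiring.Mult (Ring.semiring QP.+-*-ring)
  using (×1-homo-*) renaming (_×_ to _·1_)

ℚ-ring : AlmostCommutativeRing 0ℓ 0ℓ
ℚ-ring = fromCommutativeRing QP.+-*-commutativeRing (λ x → dec⇒maybe (0ℚ QP.≟ x))

⅛ 2ℚ : ℚ
⅛ = ½ * (½ * ½)
2ℚ = 1ℚ + 1ℚ

-- Sums over ranges of natural numbers

∑ : ℕ → (ℕ → ℚ) → ℚ
∑ n F = sum {n} (F ∘ toℕ)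

∑-cong : ∀ n {F G : ℕ → ℚ} → (∀ y → y ℕ.< n → F y ≡ G y) → ∑ n F ≡ ∑ n G
∑-cong n {F} {G} F≡G = sum-cong-≗ {n} {F ∘ toℕ} {G ∘ toℕ} (λ i → F≡G (toℕ i) (Fin.toℕ<n i))

∑-cong′ : ∀ n {F G : ℕ → ℚ} → (∀ y → F y ≡ G y) → ∑ n F ≡ ∑ n G
∑-cong′ n {F} {G} F≡G = sum-cong-≗ {n} {F ∘ toℕ} {G ∘ toℕ} (F≡G ∘ toℕ)

∑-zero : ∀ n (F : ℕ → ℚ) → (∀ y → y ℕ.< n → F y ≡ 0ℚ) → ∑ n F ≡ 0ℚ
∑-zero n F F≡0 = trans (∑-cong n {F} F≡0) (sum-replicate-zero n)

∑-+ : ∀ n (F G : ℕ → ℚ) → ∑ n (λ y → F y + G y) ≡ ∑ n F + ∑ n G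
∑-+ n F G = ∑-distrib-+ {n} (F ∘ toℕ) (G ∘ toℕ)

∑-*ˡ : ∀ n k (F : ℕ → ℚ) → ∑ n (λ y → k * F y) ≡ k * ∑ n F
∑-*ˡ n k F = sym (*-distribˡ-sum {n} k (F ∘ toℕ))

∑-swap : ∀ m n (F : ℕ → ℕ → ℚ) → ∑ m (λ x → ∑ n (F x)) ≡ ∑ n (λ y → ∑ m (λ x → F x y))
∑-swap m n F = ∑-comm {m} {n} (λ i j → F (toℕ i) (toℕ j))

∑-head : ∀ n .{{_ : NonZero n}} (F : ℕ → ℚ) → ∑ n F ≡ F 0 + ∑ (ℕ.pred n) (F ∘ suc)
∑-head (suc n) F = refl

∑-split : ∀ a b (F : ℕ → ℚ) → ∑ (a ℕ.+ b) F ≡ ∑ a F + ∑ b (λ y → F (a ℕ.+ y))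
∑-split zero    b F = sym (QP.+-identityˡ (∑ b F))
∑-split (suc a) b F = trans (cong (F 0 +_) (∑-split a b (F ∘ suc)))
                            (sym (QP.+-assoc (F 0) (∑ a (F ∘ suc)) (∑ b (λ y → F (suc a ℕ.+ y)))))

∑-blocks : ∀ N K (F : ℕ → ℚ) → ∑ (N ℕ.* K) F ≡ ∑ N (λ a → ∑ K (λ r → F (a ℕ.* K ℕ.+ r)))
∑-blocks zero    K F = refl
∑-blocks (suc N) K F = trans (∑-split K (N ℕ.* K) F) (cong (∑ K F +_) (trans
  (∑-blocks N K (λ y → F (K ℕ.+ y)))
  (∑-cong′ N λ a → ∑-cong′ K λ r → cong F (sym (ℕ.+-assoc K (a ℕ.* K) r)))))

∑-mono-≤ : ∀ n {F G : ℕ → ℚ} → (∀ y → F y ≤ G y) → ∑ n F ≤ ∑ n G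
∑-mono-≤ zero    F≤G = QP.≤-refl
∑-mono-≤ (suc n) F≤G = QP.+-mono-≤ (F≤G 0) (∑-mono-≤ n (F≤G ∘ suc))

∑-nonneg : ∀ n (F : ℕ → ℚ) → (∀ y → 0ℚ ≤ F y) → 0ℚ ≤ ∑ n F
∑-nonneg n F 0≤F = QP.≤-trans (QP.≤-reflexive (sym (sum-replicate-zero n))) (∑-mono-≤ n 0≤F)

fromℕ : ℕ → ℚ
fromℕ n = n ·1 1ℚ

fromℕ-* : ∀ a b → fromℕ (a ℕ.* b) ≡ fromℕ a * fromℕ b
fromℕ-* = ×1-homo-*

fromℕ-nonneg : ∀ a → 0ℚ ≤ fromℕ a
fromℕ-nonneg zero    = QP.≤-refl
fromℕ-nonneg (suc a) = QP.+-mono-≤ (toWitness {a? = 0ℚ QP.≤? 1ℚ} _) (fromℕ-nonneg a)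

fromℕ-mono-≤ : ∀ {a b} → a ℕ.≤ b → fromℕ a ≤ fromℕ b
fromℕ-mono-≤ {b = b} z≤n = fromℕ-nonneg b
fromℕ-mono-≤ (s≤s a≤b)   = QP.+-monoʳ-≤ 1ℚ (fromℕ-mono-≤ a≤b)

p≤∣p∣ : ∀ p → p ≤ ∣ p ∣
p≤∣p∣ p with QP.≤-total 0ℚ p
... | inj₁ 0≤p = QP.≤-reflexive (sym (QP.0≤p⇒∣p∣≡p 0≤p))
... | inj₂ p≤0 = QP.≤-trans p≤0 (QP.0≤∣p∣ p)

∣*∣-≤ : ∀ {x y a b} → ∣ x ∣ ≤ a → ∣ y ∣ ≤ b → ∣ x * y ∣ ≤ a * b
∣*∣-≤ {x} {y} {a} {b} ∣x∣≤a ∣y∣≤b = begin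
  ∣ x * y ∣      ≡⟨ QP.∣p*q∣≡∣p∣*∣q∣ x y ⟩
  ∣ x ∣ * ∣ y ∣  ≤⟨ QP.*-monoˡ-≤-nonNeg ∣ x ∣ {{QP.∣-∣-nonNeg x}} ∣y∣≤b ⟩
  ∣ x ∣ * b      ≤⟨ QP.*-monoʳ-≤-nonNeg b {{ℚ.nonNegative (QP.≤-trans (QP.0≤∣p∣ y) ∣y∣≤b)}} ∣x∣≤a ⟩
  a * b          ∎
  where open QP.≤-Reasoning

∣∑∣-≤ : ∀ n (F : ℕ → ℚ) {B} → (∀ y → ∣ F y ∣ ≤ B) → ∣ ∑ n F ∣ ≤ fromℕ n * B
∣∑∣-≤ zero    F {B} ∣F∣≤B = QP.≤-reflexive (sym (QP.*-zeroˡ B))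
∣∑∣-≤ (suc n) F {B} ∣F∣≤B = begin
  ∣ F 0 + ∑ n (F ∘ suc) ∣           ≤⟨ QP.∣p+q∣≤∣p∣+∣q∣ (F 0) (∑ n (F ∘ suc)) ⟩
  ∣ F 0 ∣ + ∣ ∑ n (F ∘ suc) ∣       ≤⟨ QP.+-mono-≤ (∣F∣≤B 0) (∣∑∣-≤ n (F ∘ suc) (∣F∣≤B ∘ suc)) ⟩
  B + fromℕ n * B                   ≡⟨ distrib B (fromℕ n) ⟩
  (1ℚ + fromℕ n) * B                ∎
  where
  open QP.≤-Reasoning
  distrib : ∀ b k → b + k * b ≡ (1ℚ + k) * b
  distrib = RingSolver.solve-∀ ℚ-ring

-- Indicators and counting

𝟙 : {P : Set} → Dec P → ℚ
𝟙 P? = if does P? then 1ℚ else 0ℚ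

𝟙-cong : {P Q : Set} (P? : Dec P) (Q? : Dec Q) → P ⇔ Q → 𝟙 P? ≡ 𝟙 Q?
𝟙-cong P? Q? P⇔Q = cong (if_then 1ℚ else 0ℚ) (does-⇔ P⇔Q P? Q?)

𝟙-no : {P : Set} (P? : Dec P) → ¬ P → 𝟙 P? ≡ 0ℚ
𝟙-no P? ¬p = cong (if_then 1ℚ else 0ℚ) (dec-false P? ¬p)

𝟙-nonneg : {P : Set} (P? : Dec P) → 0ℚ ≤ 𝟙 P?
𝟙-nonneg P? with does P?
... | true  = toWitness {a? = 0ℚ QP.≤? 1ℚ} _
... | false = QP.≤-refl

∣𝟙∣≤1 : {P : Set} (P? : Dec P) → ∣ 𝟙 P? ∣ ≤ 1ℚ
∣𝟙∣≤1 P? with does P?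
... | true  = QP.≤-refl
... | false = toWitness {a? = 0ℚ QP.≤? 1ℚ} _

𝟙-window-suc : ∀ lo x hi →
  𝟙 ((suc lo ℕ.≤? suc x) ×-dec (suc x ℕ.<? suc hi)) ≡ 𝟙 ((lo ℕ.≤? x) ×-dec (x ℕ.<? hi))
𝟙-window-suc lo x hi =
  𝟙-cong ((suc lo ℕ.≤? suc x) ×-dec (suc x ℕ.<? suc hi)) ((lo ℕ.≤? x) ×-dec (x ℕ.<? hi))
  (mk⇔ (λ (p , q) → ℕ.s≤s⁻¹ p , ℕ.s≤s⁻¹ q) (λ (p , q) → s≤s p , s≤s q))

count-point : ∀ n s t → ∑ n (λ y → 𝟙 (s ℕ.≟ t ℕ.+ y)) ≡ 𝟙 ((t ℕ.≤? s) ×-dec (s ℕ.<? t ℕ.+ n))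
count-point zero    s       zero    = refl
count-point (suc n) zero    zero    = trans (cong (1ℚ +_) (∑-zero n _ λ _ _ → refl)) (QP.+-identityʳ 1ℚ)
count-point (suc n) (suc s) zero    = trans (QP.+-identityˡ _) (count-point n s zero)
count-point n       zero    (suc t) = ∑-zero n _ λ _ _ → refl
count-point n       (suc s) (suc t) = trans (count-point n s t) (sym (𝟙-window-suc t s (t ℕ.+ n)))

count-window : ∀ n v lo hi →
  ∑ n (λ y → 𝟙 ((lo ℕ.≤? v ℕ.+ y) ×-dec (v ℕ.+ y ℕ.<? hi))) ≡ fromℕ (((hi ∸ v) ⊓ n) ∸ (lo ∸ v))
count-window zero    v       lo       hi       =
  cong fromℕ (sym (trans (cong (_∸ (lo ∸ v)) (ℕ.⊓-zeroʳ (hi ∸ v))) (ℕ.0∸n≡0 (lo ∸ v))))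
count-window (suc n) v       lo       zero     = trans
  (∑-zero (suc n) _ λ y _ → 𝟙-no ((lo ℕ.≤? v ℕ.+ y) ×-dec (v ℕ.+ y ℕ.<? 0)) λ ())
  (cong fromℕ (sym (trans (cong (λ k → (k ⊓ suc n) ∸ (lo ∸ v)) (ℕ.0∸n≡0 v)) (ℕ.0∸n≡0 (lo ∸ v)))))
count-window (suc n) zero    zero     (suc hi) = cong (1ℚ +_) (count-window n zero zero hi)
count-window (suc n) zero    (suc lo) (suc hi) =
  trans (QP.+-identityˡ _) (trans (∑-cong′ n λ y → 𝟙-window-suc lo y hi) (count-window n zero lo hi))
count-window (suc n) (suc v) zero     (suc hi) =
  trans (count-window (suc n) v zero hi) (cong (λ k → fromℕ (((hi ∸ v) ⊓ suc n) ∸ k)) (ℕ.0∸n≡0 v))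
count-window (suc n) (suc v) (suc lo) (suc hi) =
  trans (∑-cong′ (suc n) λ y → 𝟙-window-suc lo (v ℕ.+ y) hi) (count-window (suc n) v lo hi)

count-line : ∀ n n′ v t →
  ∑ n (λ y → ∑ n′ (λ z → 𝟙 (v ℕ.+ y ℕ.≟ t ℕ.+ z))) ≡ fromℕ ((((t ℕ.+ n′) ∸ v) ⊓ n) ∸ (t ∸ v))
count-line n n′ v t = trans (∑-cong′ n λ y → count-point n′ (v ℕ.+ y) t) (count-window n v t (t ℕ.+ n′))

-- Fourfold sums

∑⁴ : ℕ → (ℕ → ℕ → ℕ → ℕ → ℚ) → ℚ
∑⁴ n H = ∑ n λ a → ∑ n λ b → ∑ n λ c → ∑ n λ d → H a b c d

∑⁴[_] : (ℕ → ℕ → ℕ → ℕ → ℚ) → ℕ → (ℕ → ℕ → ℕ → ℕ → ℚ) → ℚ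
∑⁴[ W ] n u = ∑⁴ n (λ a b c d → W a b c d * u a b c d)

∑⁴-cong : ∀ n {H H′ : ℕ → ℕ → ℕ → ℕ → ℚ} → (∀ a b c d → H a b c d ≡ H′ a b c d) → ∑⁴ n H ≡ ∑⁴ n H′
∑⁴-cong n H≡H′ = ∑-cong′ n λ a → ∑-cong′ n λ b → ∑-cong′ n λ c → ∑-cong′ n λ d → H≡H′ a b c d

∑⁴-+ : ∀ n (H H′ : ℕ → ℕ → ℕ → ℕ → ℚ) →
  ∑⁴ n (λ a b c d → H a b c d + H′ a b c d) ≡ ∑⁴ n H + ∑⁴ n H′
∑⁴-+ n H H′ = trans (∑-cong′ n λ a → trans (∑-cong′ n λ b → trans
  (∑-cong′ n λ c → ∑-+ n (H a b c) (H′ a b c))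
  (∑-+ n (λ c → ∑ n (H a b c)) (λ c → ∑ n (H′ a b c))))
  (∑-+ n (λ b → ∑ n λ c → ∑ n (H a b c)) (λ b → ∑ n λ c → ∑ n (H′ a b c))))
  (∑-+ n (λ a → ∑ n λ b → ∑ n λ c → ∑ n (H a b c)) (λ a → ∑ n λ b → ∑ n λ c → ∑ n (H′ a b c)))

∑⁴-+₆ : ∀ n (H₁ H₂ H₃ H₄ H₅ H₆ : ℕ → ℕ → ℕ → ℕ → ℚ) →
  ∑⁴ n (λ a b c d → H₁ a b c d + H₂ a b c d + H₃ a b c d + H₄ a b c d + H₅ a b c d + H₆ a b c d)
  ≡ ∑⁴ n H₁ + ∑⁴ n H₂ + ∑⁴ n H₃ + ∑⁴ n H₄ + ∑⁴ n H₅ + ∑⁴ n H₆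
∑⁴-+₆ n H₁ H₂ H₃ H₄ H₅ H₆ = begin
  ∑⁴ n (λ a b c d → H₁₋₅ a b c d + H₆ a b c d)
    ≡⟨ ∑⁴-+ n H₁₋₅ H₆ ⟩
  ∑⁴ n (λ a b c d → H₁₋₄ a b c d + H₅ a b c d) + ∑⁴ n H₆
    ≡⟨ cong (_+ ∑⁴ n H₆) (∑⁴-+ n H₁₋₄ H₅) ⟩
  ∑⁴ n (λ a b c d → H₁₋₃ a b c d + H₄ a b c d) + ∑⁴ n H₅ + ∑⁴ n H₆
    ≡⟨ cong (λ s → s + ∑⁴ n H₅ + ∑⁴ n H₆) (∑⁴-+ n H₁₋₃ H₄) ⟩
  ∑⁴ n (λ a b c d → H₁₂ a b c d + H₃ a b c d) + ∑⁴ n H₄ + ∑⁴ n H₅ + ∑⁴ n H₆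
    ≡⟨ cong (λ s → s + ∑⁴ n H₄ + ∑⁴ n H₅ + ∑⁴ n H₆)
            (trans (∑⁴-+ n H₁₂ H₃) (cong (_+ ∑⁴ n H₃) (∑⁴-+ n H₁ H₂))) ⟩
  ∑⁴ n H₁ + ∑⁴ n H₂ + ∑⁴ n H₃ + ∑⁴ n H₄ + ∑⁴ n H₅ + ∑⁴ n H₆ ∎
  where
  open ≡-Reasoning
  H₁₂ H₁₋₃ H₁₋₄ H₁₋₅ : ℕ → ℕ → ℕ → ℕ → ℚ
  H₁₂  a b c d = H₁ a b c d + H₂ a b c d
  H₁₋₃ a b c d = H₁₂ a b c d + H₃ a b c d
  H₁₋₄ a b c d = H₁₋₃ a b c d + H₄ a b c d
  H₁₋₅ a b c d = H₁₋₄ a b c d + H₅ a b c d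

∑⁴-*ˡ : ∀ n k (H : ℕ → ℕ → ℕ → ℕ → ℚ) → ∑⁴ n (λ a b c d → k * H a b c d) ≡ k * ∑⁴ n H
∑⁴-*ˡ n k H = trans (∑-cong′ n λ a → trans (∑-cong′ n λ b → trans
  (∑-cong′ n λ c → ∑-*ˡ n k (H a b c))
  (∑-*ˡ n k (λ c → ∑ n (H a b c))))
  (∑-*ˡ n k (λ b → ∑ n λ c → ∑ n (H a b c))))
  (∑-*ˡ n k (λ a → ∑ n λ b → ∑ n λ c → ∑ n (H a b c)))

∑⁴-swap₁₂ : ∀ n (H : ℕ → ℕ → ℕ → ℕ → ℚ) → ∑⁴ n H ≡ ∑⁴ n (λ b a c d → H a b c d)
∑⁴-swap₁₂ n H = ∑-swap n n (λ a b → ∑ n λ c → ∑ n (H a b c))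

∑⁴-swap₂₃ : ∀ n (H : ℕ → ℕ → ℕ → ℕ → ℚ) → ∑⁴ n H ≡ ∑⁴ n (λ a c b d → H a b c d)
∑⁴-swap₂₃ n H = ∑-cong′ n λ a → ∑-swap n n (λ b c → ∑ n (H a b c))

∑⁴-swap₃₄ : ∀ n (H : ℕ → ℕ → ℕ → ℕ → ℚ) → ∑⁴ n H ≡ ∑⁴ n (λ a b d c → H a b c d)
∑⁴-swap₃₄ n H = ∑-cong′ n λ a → ∑-cong′ n λ b → ∑-swap n n (H a b)

∑⁴-swap-pairs : ∀ n (H : ℕ → ℕ → ℕ → ℕ → ℚ) → ∑⁴ n H ≡ ∑⁴ n (λ c d a b → H a b c d)
∑⁴-swap-pairs n H = begin
  ∑⁴ n H                         ≡⟨ ∑⁴-swap₂₃ n H ⟩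
  ∑⁴ n (λ a c b d → H a b c d)   ≡⟨ ∑⁴-swap₁₂ n (λ a c b d → H a b c d) ⟩
  ∑⁴ n (λ c a b d → H a b c d)   ≡⟨ ∑⁴-swap₃₄ n (λ c a b d → H a b c d) ⟩
  ∑⁴ n (λ c a d b → H a b c d)   ≡⟨ ∑⁴-swap₂₃ n (λ c a d b → H a b c d) ⟩
  ∑⁴ n (λ c d a b → H a b c d)   ∎
  where open ≡-Reasoning

quadForm : ℕ → (ℕ → ℕ → ℚ) → (ℕ → ℚ) → ℚ
quadForm n C w = ∑ n λ x → w x * ∑ n λ y → w y * C x y

quarticForm : ℕ → (ℕ → ℕ → ℕ → ℕ → ℚ) → (ℕ → ℚ) → ℚ
quarticForm n W w = ∑ n λ a → w a * ∑ n λ b → w b * ∑ n λ c → w c * ∑ n λ d → w d * W a b c d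

quadForm-cong : ∀ n {C C′ : ℕ → ℕ → ℚ} (w : ℕ → ℚ) →
  (∀ x y → x ℕ.< n → y ℕ.< n → C x y ≡ C′ x y) → quadForm n C w ≡ quadForm n C′ w
quadForm-cong n w C≡C′ =
  ∑-cong n λ x x<n → cong (w x *_) (∑-cong n λ y y<n → cong (w y *_) (C≡C′ x y x<n y<n))

quadForm-+ : ∀ n (C C′ : ℕ → ℕ → ℚ) (w : ℕ → ℚ) →
  quadForm n (λ x y → C x y + C′ x y) w ≡ quadForm n C w + quadForm n C′ w
quadForm-+ n C C′ w = trans
  (∑-cong′ n λ x → trans
    (cong (w x *_) (trans (∑-cong′ n λ y → QP.*-distribˡ-+ (w y) (C x y) (C′ x y))
                          (∑-+ n (λ y → w y * C x y) (λ y → w y * C′ x y))))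
    (QP.*-distribˡ-+ (w x) (∑ n λ y → w y * C x y) (∑ n λ y → w y * C′ x y)))
  (∑-+ n (λ x → w x * ∑ n λ y → w y * C x y) (λ x → w x * ∑ n λ y → w y * C′ x y))

quadForm-*ˡ : ∀ n k (C : ℕ → ℕ → ℚ) (w : ℕ → ℚ) → quadForm n (λ x y → k * C x y) w ≡ k * quadForm n C w
quadForm-*ˡ n k C w = trans
  (∑-cong′ n λ x → trans
    (cong (w x *_) (trans (∑-cong′ n λ y → exchange (w y) k (C x y)) (∑-*ˡ n k (λ y → w y * C x y))))
    (exchange (w x) k (∑ n λ y → w y * C x y)))
  (∑-*ˡ n k (λ x → w x * ∑ n λ y → w y * C x y))
  where
  exchange : ∀ a b c → a * (b * c) ≡ b * (a * c)
  exchange = RingSolver.solve-∀ ℚ-ring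

quarticForm-bound : ∀ n (W : ℕ → ℕ → ℕ → ℕ → ℚ) (w : ℕ → ℚ) {ω} →
  (∀ a b c d → ∣ W a b c d ∣ ≤ 1ℚ) → (∀ y → ∣ w y ∣ ≤ ω) →
  ∣ quarticForm n W w ∣ ≤ fromℕ n * (ω * (fromℕ n * (ω * (fromℕ n * (ω * (fromℕ n * (ω * 1ℚ)))))))
quarticForm-bound n W w ∣W∣≤1 ∣w∣≤ω =
  ∣∑∣-≤ n _ λ a → ∣*∣-≤ (∣w∣≤ω a) (∣∑∣-≤ n _ λ b → ∣*∣-≤ (∣w∣≤ω b) (∣∑∣-≤ n _ λ c → ∣*∣-≤ (∣w∣≤ω c)
    (∣∑∣-≤ n _ λ d → ∣*∣-≤ (∣w∣≤ω d) (∣W∣≤1 a b c d))))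

∑⁴-pair₁₂ : ∀ n (W : ℕ → ℕ → ℕ → ℕ → ℚ) (w : ℕ → ℚ) →
  ∑⁴[ W ] n (λ a b _ _ → w a * w b) ≡ quadForm n (λ a b → ∑ n λ c → ∑ n (W a b c)) w
∑⁴-pair₁₂ n W w = ∑-cong′ n λ a → trans
  (∑-cong′ n λ b → trans (∑²-*ʳ (w a * w b) (W a b)) (QP.*-assoc (w a) (w b) (∑ n λ c → ∑ n (W a b c))))
  (∑-*ˡ n (w a) (λ b → w b * ∑ n λ c → ∑ n (W a b c)))
  where
  ∑²-*ʳ : ∀ k (F : ℕ → ℕ → ℚ) → ∑ n (λ c → ∑ n (λ d → F c d * k)) ≡ k * ∑ n (λ c → ∑ n (F c))
  ∑²-*ʳ k F = trans (∑-cong′ n λ c → trans (∑-cong′ n λ d → QP.*-comm (F c d) k) (∑-*ˡ n k (F c)))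
                    (∑-*ˡ n k (λ c → ∑ n (F c)))

∑⁴-pair₁₃ : ∀ n (W : ℕ → ℕ → ℕ → ℕ → ℚ) (w : ℕ → ℚ) →
  ∑⁴[ W ] n (λ a _ c _ → w a * w c) ≡ quadForm n (λ a c → ∑ n λ b → ∑ n (W a b c)) w
∑⁴-pair₁₃ n W w = trans (∑⁴-swap₂₃ n (λ a b c d → W a b c d * (w a * w c)))
                        (∑⁴-pair₁₂ n (λ a c b d → W a b c d) w)

∑⁴-pair₁₄ : ∀ n (W : ℕ → ℕ → ℕ → ℕ → ℚ) (w : ℕ → ℚ) →
  ∑⁴[ W ] n (λ a _ _ d → w a * w d) ≡ quadForm n (λ a d → ∑ n λ b → ∑ n λ c → W a b c d) w
∑⁴-pair₁₄ n W w = begin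
  ∑⁴ n (λ a b c d → W a b c d * (w a * w d))  ≡⟨ ∑⁴-swap₃₄ n (λ a b c d → W a b c d * (w a * w d)) ⟩
  ∑⁴ n (λ a b d c → W a b c d * (w a * w d))  ≡⟨ ∑⁴-swap₂₃ n (λ a b d c → W a b c d * (w a * w d)) ⟩
  ∑⁴ n (λ a d b c → W a b c d * (w a * w d))  ≡⟨ ∑⁴-pair₁₂ n (λ a d b c → W a b c d) w ⟩
  quadForm n (λ a d → ∑ n λ b → ∑ n λ c → W a b c d) w ∎
  where open ≡-Reasoning

∑⁴-pair₂₄ : ∀ n (W : ℕ → ℕ → ℕ → ℕ → ℚ) (w : ℕ → ℚ) →
  ∑⁴[ W ] n (λ _ b _ d → w b * w d) ≡ quadForm n (λ b d → ∑ n λ a → ∑ n λ c → W a b c d) w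
∑⁴-pair₂₄ n W w = begin
  ∑⁴ n (λ a b c d → W a b c d * (w b * w d))  ≡⟨ ∑⁴-swap₁₂ n (λ a b c d → W a b c d * (w b * w d)) ⟩
  ∑⁴ n (λ b a c d → W a b c d * (w b * w d))  ≡⟨ ∑⁴-swap₃₄ n (λ b a c d → W a b c d * (w b * w d)) ⟩
  ∑⁴ n (λ b a d c → W a b c d * (w b * w d))  ≡⟨ ∑⁴-swap₂₃ n (λ b a d c → W a b c d * (w b * w d)) ⟩
  ∑⁴ n (λ b d a c → W a b c d * (w b * w d))  ≡⟨ ∑⁴-pair₁₂ n (λ b d a c → W a b c d) w ⟩
  quadForm n (λ b d → ∑ n λ a → ∑ n λ c → W a b c d) w ∎
  where open ≡-Reasoning

∑⁴-quartic : ∀ n (W : ℕ → ℕ → ℕ → ℕ → ℚ) (w : ℕ → ℚ) →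
  ∑⁴[ W ] n (λ a b c d → w a * (w b * (w c * w d))) ≡ quarticForm n W w
∑⁴-quartic n W w = ∑-cong′ n λ a → trans (∑-cong′ n (inner a)) (∑-*ˡ n (w a) (λ b → w b * C a b))
  where
  D : ℕ → ℕ → ℕ → ℚ
  D a b c = ∑ n λ d → w d * W a b c d
  C : ℕ → ℕ → ℚ
  C a b = ∑ n λ c → w c * D a b c
  regroup : ∀ x a b c d → x * (a * (b * (c * d))) ≡ ((a * b) * c) * (d * x)
  regroup = RingSolver.solve-∀ ℚ-ring
  inner : ∀ a b → ∑ n (λ c → ∑ n λ d → W a b c d * (w a * (w b * (w c * w d)))) ≡ w a * (w b * C a b)
  inner a b = begin
    ∑ n (λ c → ∑ n λ d → W a b c d * (w a * (w b * (w c * w d))))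
      ≡⟨ ∑-cong′ n (λ c → trans (∑-cong′ n λ d → regroup (W a b c d) (w a) (w b) (w c) (w d))
                                (∑-*ˡ n ((w a * w b) * w c) (λ d → w d * W a b c d))) ⟩
    ∑ n (λ c → ((w a * w b) * w c) * D a b c)
      ≡⟨ ∑-cong′ n (λ c → QP.*-assoc (w a * w b) (w c) (D a b c)) ⟩
    ∑ n (λ c → (w a * w b) * (w c * D a b c))
      ≡⟨ ∑-*ˡ n (w a * w b) (λ c → w c * D a b c) ⟩
    (w a * w b) * C a b
      ≡⟨ QP.*-assoc (w a) (w b) (C a b) ⟩
    w a * (w b * C a b) ∎
    where open ≡-Reasoning

Π⁴ : (ℕ → ℚ) → ℕ → ℕ → ℕ → ℕ → ℚ
Π⁴ F a b c d = F a * (F b * (F c * (F d * 1ℚ)))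

expand-½ : ∀ n (W : ℕ → ℕ → ℕ → ℕ → ℚ) (g : ℕ → ℚ) →
  ∑⁴[ W ] n (Π⁴ (λ y → ½ + g y)) + ∑⁴[ W ] n (Π⁴ (λ y → 1ℚ - (½ + g y)))
  ≡ ⅛ * ∑⁴[ W ] n (Π⁴ (λ _ → 1ℚ))
    + (½ * (∑⁴[ W ] n (λ a b _ _ → g a * g b) + ∑⁴[ W ] n (λ a _ c _ → g a * g c)
          + ∑⁴[ W ] n (λ a _ _ d → g a * g d) + ∑⁴[ W ] n (λ _ b c _ → g b * g c)
          + ∑⁴[ W ] n (λ _ b _ d → g b * g d) + ∑⁴[ W ] n (λ _ _ c d → g c * g d))
       + 2ℚ * ∑⁴[ W ] n (λ a b c d → g a * (g b * (g c * g d))))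
expand-½ n W g = begin
  ∑⁴ n X₊ + ∑⁴ n X₋
    ≡⟨ ∑⁴-+ n X₊ X₋ ⟨
  ∑⁴ n (λ a b c d → X₊ a b c d + X₋ a b c d)
    ≡⟨ ∑⁴-cong n (λ a b c d → pointwise (W a b c d) (g a) (g b) (g c) (g d)) ⟩
  ∑⁴ n (λ a b c d → ⅛ * Y a b c d + (½ * Z a b c d + 2ℚ * Q a b c d))
    ≡⟨ ∑⁴-+ n (λ a b c d → ⅛ * Y a b c d) (λ a b c d → ½ * Z a b c d + 2ℚ * Q a b c d) ⟩
  ∑⁴ n (λ a b c d → ⅛ * Y a b c d) + ∑⁴ n (λ a b c d → ½ * Z a b c d + 2ℚ * Q a b c d)
    ≡⟨ cong₂ _+_ (∑⁴-*ˡ n ⅛ Y)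
         (trans (∑⁴-+ n (λ a b c d → ½ * Z a b c d) (λ a b c d → 2ℚ * Q a b c d))
                (cong₂ _+_ (trans (∑⁴-*ˡ n ½ Z) (cong (½ *_) (∑⁴-+₆ n Z₁₂ Z₁₃ Z₁₄ Z₂₃ Z₂₄ Z₃₄)))
                           (∑⁴-*ˡ n 2ℚ Q))) ⟩
  ⅛ * ∑⁴ n Y + (½ * (∑⁴ n Z₁₂ + ∑⁴ n Z₁₃ + ∑⁴ n Z₁₄ + ∑⁴ n Z₂₃ + ∑⁴ n Z₂₄ + ∑⁴ n Z₃₄) + 2ℚ * ∑⁴ n Q) ∎
  where
  open ≡-Reasoning
  X₊ X₋ Y Z₁₂ Z₁₃ Z₁₄ Z₂₃ Z₂₄ Z₃₄ Z Q : ℕ → ℕ → ℕ → ℕ → ℚ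
  X₊ a b c d = W a b c d * Π⁴ (λ y → ½ + g y) a b c d
  X₋ a b c d = W a b c d * Π⁴ (λ y → 1ℚ - (½ + g y)) a b c d
  Y  a b c d = W a b c d * Π⁴ (λ _ → 1ℚ) a b c d
  Z₁₂ a b c d = W a b c d * (g a * g b)
  Z₁₃ a b c d = W a b c d * (g a * g c)
  Z₁₄ a b c d = W a b c d * (g a * g d)
  Z₂₃ a b c d = W a b c d * (g b * g c)
  Z₂₄ a b c d = W a b c d * (g b * g d)
  Z₃₄ a b c d = W a b c d * (g c * g d)
  Z a b c d = Z₁₂ a b c d + Z₁₃ a b c d + Z₁₄ a b c d + Z₂₃ a b c d + Z₂₄ a b c d + Z₃₄ a b c d
  Q a b c d = W a b c d * (g a * (g b * (g c * g d)))
  pointwise : ∀ x a b c d →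
    x * ((½ + a) * ((½ + b) * ((½ + c) * ((½ + d) * 1ℚ))))
    + x * ((1ℚ - (½ + a)) * ((1ℚ - (½ + b)) * ((1ℚ - (½ + c)) * ((1ℚ - (½ + d)) * 1ℚ))))
    ≡ ⅛ * (x * (1ℚ * (1ℚ * (1ℚ * (1ℚ * 1ℚ)))))
      + (½ * (x * (a * b) + x * (a * c) + x * (a * d) + x * (b * c) + x * (b * d) + x * (c * d))
         + 2ℚ * (x * (a * (b * (c * d)))))
  pointwise = RingSolver.solve-∀ ℚ-ring

-- T_L as a fourfold sum

sumℚ-tabulate : ∀ n (h : Fin n → ℚ) → sumℚ (tabulate h) ≡ sum h
sumℚ-tabulate zero    h = refl
sumℚ-tabulate (suc n) h = cong (h Fin.zero +_) (sumℚ-tabulate n (h ∘ Fin.suc))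

sumTuples-suc : ∀ n k (g : Vec (Fin n) (suc k) → ℚ) →
  sumTuples n (suc k) g ≡ sum (λ i → sumTuples n k (λ xs → g (i ∷ xs)))
sumTuples-suc n k g = trans (cong sumℚ (List.map-tabulate id G)) (sumℚ-tabulate n G)
  where
  G : Fin n → ℚ
  G i = sumTuples n k (λ xs → g (i ∷ xs))

sumTuples-4 : ∀ n (g : Vec (Fin n) 4 → ℚ) (H : ℕ → ℕ → ℕ → ℕ → ℚ) →
  (∀ i j k l → g (i ∷ j ∷ k ∷ l ∷ []) ≡ H (toℕ i) (toℕ j) (toℕ k) (toℕ l)) → sumTuples n 4 g ≡ ∑⁴ n H
sumTuples-4 n g H g≡H =
  trans (sumTuples-suc n 3 g) (sum-cong-≗ λ i →
  trans (sumTuples-suc n 2 (λ xs → g (i ∷ xs))) (sum-cong-≗ λ j →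
  trans (sumTuples-suc n 1 (λ xs → g (i ∷ j ∷ xs))) (sum-cong-≗ λ k →
  trans (sumTuples-suc n 0 (λ xs → g (i ∷ j ∷ k ∷ xs))) (sum-cong-≗ λ l → g≡H i j k l))))

-- Defs keeps the indicator used by T local, so the integrand of T is named here by unification.
T-integrand : ∀ {k} (a : Vec ℤ k) n (f : Fin n → ℚ) → Σ (Vec (Fin n) k → ℚ) λ g → T a n f ≡ sumTuples n k g
T-integrand a n f = _ , refl

T-integrand-≡ : ∀ {k} (a : Vec ℤ k) n (f : Fin n → ℚ) (xs : Vec (Fin n) k) →
  proj₁ (T-integrand a n f) xs ≡ 𝟙 (evalForm a xs ℤ.≟ ℤ.+ 0) * prodF f xs
T-integrand-≡ a n f xs with evalForm a xs ℤ.≟ ℤ.+ 0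
... | yes _ = sym (QP.*-identityˡ (prodF f xs))
... | no  _ = sym (QP.*-zeroˡ (prodF f xs))

-- Positions are 0-based: (a, b, c, d) stands for (a + 1, b + 1, c + 1, d + 1) ∈ [n]⁴,
-- and the shift cancels in L.
𝟙L : ℕ → ℕ → ℕ → ℕ → ℚ
𝟙L a b c d = 𝟙 (a ℕ.+ 2 ℕ.* b ℕ.≟ c ℕ.+ 2 ℕ.* d)

L-root⇔ : ∀ {n} (i j k l : Fin n) →
  evalForm L (i ∷ j ∷ k ∷ l ∷ []) ≡ ℤ.+ 0 ⇔ toℕ i ℕ.+ 2 ℕ.* toℕ j ≡ toℕ k ℕ.+ 2 ℕ.* toℕ l
L-root⇔ i j k l = mk⇔
  (λ e → ℤ.+-injective (ℤ.i-j≡0⇒i≡j _ _ (trans (sym L≡) e)))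
  (λ e → trans L≡ (ℤ.i≡j⇒i-j≡0 (cong +_ e)))
  where
  open import Data.Integer using (+_)
  L-shifted : ∀ a b c d →
    + 1 ℤ.* (+ 1 ℤ.+ a) ℤ.+ (+ 2 ℤ.* (+ 1 ℤ.+ b)
      ℤ.+ (ℤ.- + 1 ℤ.* (+ 1 ℤ.+ c) ℤ.+ (ℤ.- + 2 ℤ.* (+ 1 ℤ.+ d) ℤ.+ + 0)))
    ≡ (a ℤ.+ + 2 ℤ.* b) ℤ.- (c ℤ.+ + 2 ℤ.* d)
  L-shifted = ℤ-RingSolver.solve-∀
  pos-a+2b : ∀ a b → + (a ℕ.+ 2 ℕ.* b) ≡ + a ℤ.+ + 2 ℤ.* + b
  pos-a+2b a b = trans (ℤ.pos-+ a (2 ℕ.* b)) (cong (ℤ._+_ (+ a)) (ℤ.pos-* 2 b))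
  L≡ : evalForm L (i ∷ j ∷ k ∷ l ∷ []) ≡ + (toℕ i ℕ.+ 2 ℕ.* toℕ j) ℤ.- + (toℕ k ℕ.+ 2 ℕ.* toℕ l)
  L≡ = trans (L-shifted (+ toℕ i) (+ toℕ j) (+ toℕ k) (+ toℕ l))
             (sym (cong₂ ℤ._-_ (pos-a+2b (toℕ i) (toℕ j)) (pos-a+2b (toℕ k) (toℕ l))))

T-L : ∀ n (F : ℕ → ℚ) → T L n (F ∘ toℕ) ≡ ∑⁴[ 𝟙L ] n (Π⁴ F)
T-L n F = trans (proj₂ (T-integrand L n (F ∘ toℕ)))
  (sumTuples-4 n (proj₁ (T-integrand L n (F ∘ toℕ))) (λ a b c d → 𝟙L a b c d * Π⁴ F a b c d) λ i j k l →
    trans (T-integrand-≡ L n (F ∘ toℕ) (i ∷ j ∷ k ∷ l ∷ []))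
          (cong (_* Π⁴ F (toℕ i) (toℕ j) (toℕ k) (toℕ l))
                (𝟙-cong (evalForm L (i ∷ j ∷ k ∷ l ∷ []) ℤ.≟ ℤ.+ 0) (_ ℕ.≟ _) (L-root⇔ i j k l))))

T-L-one-nonneg : ∀ n → 0ℚ ≤ T L n one
T-L-one-nonneg n = subst (0ℚ ≤_) (sym (T-L n (λ _ → 1ℚ)))
  (∑-nonneg n _ λ a → ∑-nonneg n _ λ b → ∑-nonneg n _ λ c → ∑-nonneg n _ λ d →
    subst (0ℚ ≤_) (sym (QP.*-identityʳ (𝟙L a b c d))) (𝟙-nonneg (a ℕ.+ 2 ℕ.* b ℕ.≟ c ℕ.+ 2 ℕ.* d)))

∑⁴[𝟙L]-swap-pairs : ∀ n (u : ℕ → ℕ → ℕ → ℕ → ℚ) → ∑⁴[ 𝟙L ] n u ≡ ∑⁴[ 𝟙L ] n (λ a b c d → u c d a b)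
∑⁴[𝟙L]-swap-pairs n u = trans (∑⁴-swap-pairs n (λ a b c d → 𝟙L a b c d * u a b c d))
  (∑⁴-cong n λ a b c d → cong (_* u c d a b)
    (𝟙-cong (c ℕ.+ 2 ℕ.* d ℕ.≟ a ℕ.+ 2 ℕ.* b) (a ℕ.+ 2 ℕ.* b ℕ.≟ c ℕ.+ 2 ℕ.* d) (mk⇔ sym sym)))

-- Spike functions

spike : (K : ℕ) .{{_ : NonZero K}} → (ℕ → ℚ) → ℕ → ℚ
spike K h y = if does (K ∣? y) then h (y / K) else 0ℚ

module _ (K : ℕ) .{{_ : NonZero K}} (h : ℕ → ℚ) where

  spike-preserves : (P : ℚ → Set) → P 0ℚ → (∀ a → P (h a)) → ∀ y → P (spike K h y)
  spike-preserves P P0 Ph y with does (K ∣? y)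
  ... | true  = Ph (y / K)
  ... | false = P0

  spike-multiple : ∀ a → spike K h (a ℕ.* K) ≡ h a
  spike-multiple a = trans (cong (if_then h (a ℕ.* K / K) else 0ℚ) (dec-true (K ∣? a ℕ.* K) (n∣m*n a)))
                           (cong h (m*n/n≡m a K))

  spike-between : ∀ a r → 0 ℕ.< r → r ℕ.< K → spike K h (a ℕ.* K ℕ.+ r) ≡ 0ℚ
  spike-between a r 0<r r<K =
    cong (if_then h ((a ℕ.* K ℕ.+ r) / K) else 0ℚ) (dec-false (K ∣? a ℕ.* K ℕ.+ r) K∤)
    where
    K∤ : ¬ K ∣ a ℕ.* K ℕ.+ r
    K∤ K∣ = ℕ.<⇒≱ r<K (∣⇒≤ {{ℕ.>-nonZero 0<r}} (∣m+n∣m⇒∣n K∣ (n∣m*n a)))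

  ∑-spike-block : ∀ a (Φ : ℕ → ℚ) →
    ∑ K (λ r → spike K h (a ℕ.* K ℕ.+ r) * Φ (a ℕ.* K ℕ.+ r)) ≡ h a * Φ (a ℕ.* K)
  ∑-spike-block a Φ = begin
    ∑ K G                                          ≡⟨ ∑-head K G ⟩
    G 0 + ∑ (ℕ.pred K) (G ∘ suc)                   ≡⟨ cong₂ _+_ G0 (∑-zero (ℕ.pred K) (G ∘ suc) Gsuc) ⟩
    h a * Φ (a ℕ.* K) + 0ℚ                         ≡⟨ QP.+-identityʳ (h a * Φ (a ℕ.* K)) ⟩
    h a * Φ (a ℕ.* K)                              ∎
    where
    open ≡-Reasoning
    G : ℕ → ℚ
    G r = spike K h (a ℕ.* K ℕ.+ r) * Φ (a ℕ.* K ℕ.+ r)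
    G0 : G 0 ≡ h a * Φ (a ℕ.* K)
    G0 rewrite ℕ.+-identityʳ (a ℕ.* K) = cong (_* Φ (a ℕ.* K)) (spike-multiple a)
    Gsuc : ∀ r → r ℕ.< ℕ.pred K → G (suc r) ≡ 0ℚ
    Gsuc r r<K-1 = trans
      (cong (_* Φ (a ℕ.* K ℕ.+ suc r)) (spike-between a (suc r) (s≤s z≤n) (ℕ.m≤pred[n]⇒suc[m]≤n r<K-1)))
      (QP.*-zeroˡ (Φ (a ℕ.* K ℕ.+ suc r)))

  ∑-spike : ∀ N (Φ : ℕ → ℚ) → ∑ (N ℕ.* K) (λ y → spike K h y * Φ y) ≡ ∑ N (λ a → h a * Φ (a ℕ.* K))
  ∑-spike N Φ = trans (∑-blocks N K (λ y → spike K h y * Φ y)) (∑-cong′ N λ a → ∑-spike-block a Φ)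

  quadForm-spike : ∀ N C → quadForm (N ℕ.* K) C (spike K h) ≡ quadForm N (λ a b → C (a ℕ.* K) (b ℕ.* K)) h
  quadForm-spike N C = trans
    (∑-cong′ (N ℕ.* K) λ x → cong (spike K h x *_) (∑-spike N (C x)))
    (∑-spike N λ x → ∑ N λ b → h b * C x (b ℕ.* K))

  quarticForm-spike : ∀ N W → quarticForm (N ℕ.* K) W (spike K h)
                              ≡ quarticForm N (λ a b c d → W (a ℕ.* K) (b ℕ.* K) (c ℕ.* K) (d ℕ.* K)) h
  quarticForm-spike N W = trans (∑-cong′ (N ℕ.* K) λ a → cong (spike K h a *_) (trans
    (∑-cong′ (N ℕ.* K) λ b → cong (spike K h b *_) (trans
      (∑-cong′ (N ℕ.* K) λ c → cong (spike K h c *_) (∑-spike N (W a b c)))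
      (∑-spike N λ c → ∑ N λ d → h d * W a b c (d ℕ.* K))))
    (∑-spike N λ b → ∑ N λ c → h c * ∑ N λ d → h d * W a b (c ℕ.* K) (d ℕ.* K))))
    (∑-spike N λ a → ∑ N λ b → h b * ∑ N λ c → h c * ∑ N λ d → h d * W a (b ℕ.* K) (c ℕ.* K) (d ℕ.* K))

-- Solutions with two coordinates at spikes

module _ {x y x′ y′ : ℕ} (x≡ : x ≡ 2 ℕ.* x′) (y≡ : y ≡ 2 ℕ.* y′) where

  halve-≡⇔ : x ≡ y ⇔ x′ ≡ y′
  halve-≡⇔ = mk⇔ (λ e → ℕ.*-cancelˡ-≡ x′ y′ 2 (trans (sym x≡) (trans e y≡)))
                 (λ e → trans x≡ (trans (cong (2 ℕ.*_) e) (sym y≡)))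

  halve-≤⇔ : x ℕ.≤ y ⇔ x′ ℕ.≤ y′
  halve-≤⇔ = mk⇔ (λ le → ℕ.*-cancelˡ-≤ 2 (subst₂ ℕ._≤_ x≡ y≡ le))
                 (λ le → subst₂ ℕ._≤_ (sym x≡) (sym y≡) (ℕ.*-monoʳ-≤ 2 le))

  halve-<⇔ : x ℕ.< y ⇔ x′ ℕ.< y′
  halve-<⇔ = mk⇔ (λ lt → ℕ.*-cancelˡ-< 2 x′ y′ (subst₂ ℕ._<_ x≡ y≡ lt))
                 (λ lt → subst₂ ℕ._<_ (sym x≡) (sym y≡) (ℕ.*-monoʳ-< 2 lt))

*-distribˡ-window : ∀ m u v w N →
  (((m ℕ.* u ℕ.+ m ℕ.* w) ∸ m ℕ.* v) ⊓ (m ℕ.* N)) ∸ (m ℕ.* u ∸ m ℕ.* v)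
  ≡ m ℕ.* ((((u ℕ.+ w) ∸ v) ⊓ N) ∸ (u ∸ v))
*-distribˡ-window m u v w N = begin
  (((m ℕ.* u ℕ.+ m ℕ.* w) ∸ m ℕ.* v) ⊓ (m ℕ.* N)) ∸ (m ℕ.* u ∸ m ℕ.* v)
    ≡⟨ cong₂ (λ x y → ((x ∸ m ℕ.* v) ⊓ (m ℕ.* N)) ∸ y) (ℕ.*-distribˡ-+ m u w) (ℕ.*-distribˡ-∸ m u v) ⟨
  ((m ℕ.* (u ℕ.+ w) ∸ m ℕ.* v) ⊓ (m ℕ.* N)) ∸ m ℕ.* (u ∸ v)
    ≡⟨ cong (λ x → (x ⊓ (m ℕ.* N)) ∸ m ℕ.* (u ∸ v)) (ℕ.*-distribˡ-∸ m (u ℕ.+ w) v) ⟨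
  (m ℕ.* ((u ℕ.+ w) ∸ v) ⊓ (m ℕ.* N)) ∸ m ℕ.* (u ∸ v)
    ≡⟨ cong (_∸ m ℕ.* (u ∸ v)) (ℕ.*-distribˡ-⊓ m ((u ℕ.+ w) ∸ v) N) ⟨
  m ℕ.* (((u ℕ.+ w) ∸ v) ⊓ N) ∸ m ℕ.* (u ∸ v)
    ≡⟨ ℕ.*-distribˡ-∸ m (((u ℕ.+ w) ∸ v) ⊓ N) (u ∸ v) ⟨
  m ℕ.* ((((u ℕ.+ w) ∸ v) ⊓ N) ∸ (u ∸ v)) ∎
  where open ≡-Reasoning

A₁₃ A₁₄ A₂₄ : ℕ → ℕ → ℕ → ℕ
A₁₃ N a c = (((c ℕ.+ 2 ℕ.* N) ∸ a) ⊓ (2 ℕ.* N)) ∸ (c ∸ a)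
A₁₄ N a d = (((2 ℕ.* d ℕ.+ N) ∸ a) ⊓ (2 ℕ.* N)) ∸ (2 ℕ.* d ∸ a)
A₂₄ N b d = (((4 ℕ.* d ℕ.+ 2 ℕ.* N) ∸ 4 ℕ.* b) ⊓ (2 ℕ.* N)) ∸ (4 ℕ.* d ∸ 4 ℕ.* b)

A₁₂ : ℕ → ℕ → ℕ
A₁₂ N S with S ℕ.<? N | S ℕ.<? 2 ℕ.* N
... | yes _ | _     = S
... | no  _ | yes _ = N
... | no  _ | no  _ = 3 ℕ.* N ∸ S

B₁₂ : ℕ → ℕ → ℚ
B₁₂ N S with S ℕ.<? N | S ℕ.<? 2 ℕ.* N
... | yes _ | _     = 1ℚ
... | no  _ | yes _ = 0ℚ
... | no  _ | no  _ = - 1ℚ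

module PairCounts (m N : ℕ) where

  n : ℕ
  n = N ℕ.* (2 ℕ.* m)

  private
    n≡m*2N : ∀ m N → N ℕ.* (2 ℕ.* m) ≡ m ℕ.* (2 ℕ.* N)
    n≡m*2N = solve-∀
    n≡M+M : ∀ m N → N ℕ.* (2 ℕ.* m) ≡ m ℕ.* N ℕ.+ m ℕ.* N
    n≡M+M = solve-∀
    3M≡n+M : ∀ m N → m ℕ.* (3 ℕ.* N) ≡ N ℕ.* (2 ℕ.* m) ℕ.+ m ℕ.* N
    3M≡n+M = solve-∀
    scaled : ∀ m x y → x ℕ.* (2 ℕ.* m) ℕ.+ 2 ℕ.* y ≡ 2 ℕ.* (m ℕ.* x ℕ.+ y)
    scaled = solve-∀
    scaled-S : ∀ m a b → a ℕ.* (2 ℕ.* m) ℕ.+ 2 ℕ.* (b ℕ.* (2 ℕ.* m)) ≡ 2 ℕ.* (m ℕ.* (a ℕ.+ 2 ℕ.* b))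
    scaled-S = solve-∀
    doubled : ∀ m x → 2 ℕ.* (x ℕ.* (2 ℕ.* m)) ≡ 2 ℕ.* (m ℕ.* (2 ℕ.* x))
    doubled = solve-∀
    doubled-shift : ∀ m N x →
      2 ℕ.* (x ℕ.* (2 ℕ.* m)) ℕ.+ N ℕ.* (2 ℕ.* m) ≡ 2 ℕ.* (m ℕ.* (2 ℕ.* x) ℕ.+ m ℕ.* N)
    doubled-shift = solve-∀
    quadrupled : ∀ m x y → y ℕ.+ 2 ℕ.* (x ℕ.* (2 ℕ.* m)) ≡ m ℕ.* (4 ℕ.* x) ℕ.+ y
    quadrupled = solve-∀
    shifted : ∀ m N d → 2 ℕ.* d ℕ.+ N ℕ.* (2 ℕ.* m) ≡ 2 ℕ.* (d ℕ.+ m ℕ.* N)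
    shifted = solve-∀

  count₁₃ : ∀ a c →
    ∑ n (λ b → ∑ n (λ d → 𝟙L (a ℕ.* (2 ℕ.* m)) b (c ℕ.* (2 ℕ.* m)) d)) ≡ fromℕ m * fromℕ (A₁₃ N a c)
  count₁₃ a c = begin
    ∑ n (λ b → ∑ n (λ d → 𝟙L (a ℕ.* (2 ℕ.* m)) b (c ℕ.* (2 ℕ.* m)) d))
      ≡⟨ ∑-cong′ n (λ b → ∑-cong′ n λ d → 𝟙-cong (_ ℕ.≟ _) (m ℕ.* a ℕ.+ b ℕ.≟ m ℕ.* c ℕ.+ d)
                                                  (halve-≡⇔ (scaled m a b) (scaled m c d))) ⟩
    ∑ n (λ b → ∑ n (λ d → 𝟙 (m ℕ.* a ℕ.+ b ℕ.≟ m ℕ.* c ℕ.+ d)))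
      ≡⟨ count-line n n (m ℕ.* a) (m ℕ.* c) ⟩
    fromℕ ((((m ℕ.* c ℕ.+ n) ∸ m ℕ.* a) ⊓ n) ∸ (m ℕ.* c ∸ m ℕ.* a))
      ≡⟨ cong fromℕ (trans (cong (λ k → (((m ℕ.* c ℕ.+ k) ∸ m ℕ.* a) ⊓ k) ∸ (m ℕ.* c ∸ m ℕ.* a))
                                 (n≡m*2N m N))
                           (*-distribˡ-window m c a (2 ℕ.* N) (2 ℕ.* N))) ⟩
    fromℕ (m ℕ.* A₁₃ N a c)
      ≡⟨ fromℕ-* m (A₁₃ N a c) ⟩
    fromℕ m * fromℕ (A₁₃ N a c) ∎
    where open ≡-Reasoning

  count₂₄ : ∀ b d →
    ∑ n (λ a → ∑ n (λ c → 𝟙L a (b ℕ.* (2 ℕ.* m)) c (d ℕ.* (2 ℕ.* m)))) ≡ fromℕ m * fromℕ (A₂₄ N b d)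
  count₂₄ b d = begin
    ∑ n (λ a → ∑ n (λ c → 𝟙L a (b ℕ.* (2 ℕ.* m)) c (d ℕ.* (2 ℕ.* m))))
      ≡⟨ ∑-cong′ n (λ a → ∑-cong′ n λ c →
           cong₂ (λ x y → 𝟙 (x ℕ.≟ y)) (quadrupled m b a) (quadrupled m d c)) ⟩
    ∑ n (λ a → ∑ n (λ c → 𝟙 (m ℕ.* (4 ℕ.* b) ℕ.+ a ℕ.≟ m ℕ.* (4 ℕ.* d) ℕ.+ c)))
      ≡⟨ count-line n n (m ℕ.* (4 ℕ.* b)) (m ℕ.* (4 ℕ.* d)) ⟩
    fromℕ ((((m ℕ.* (4 ℕ.* d) ℕ.+ n) ∸ m ℕ.* (4 ℕ.* b)) ⊓ n) ∸ (m ℕ.* (4 ℕ.* d) ∸ m ℕ.* (4 ℕ.* b)))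
      ≡⟨ cong fromℕ (trans (cong (λ k → (((m ℕ.* (4 ℕ.* d) ℕ.+ k) ∸ m ℕ.* (4 ℕ.* b)) ⊓ k)
                                          ∸ (m ℕ.* (4 ℕ.* d) ∸ m ℕ.* (4 ℕ.* b))) (n≡m*2N m N))
                           (*-distribˡ-window m (4 ℕ.* d) (4 ℕ.* b) (2 ℕ.* N) (2 ℕ.* N))) ⟩
    fromℕ (m ℕ.* A₂₄ N b d)
      ≡⟨ fromℕ-* m (A₂₄ N b d) ⟩
    fromℕ m * fromℕ (A₂₄ N b d) ∎
    where open ≡-Reasoning

  count₁₄ : ∀ a d →
    ∑ n (λ b → ∑ n (λ c → 𝟙L (a ℕ.* (2 ℕ.* m)) b c (d ℕ.* (2 ℕ.* m)))) ≡ fromℕ m * fromℕ (A₁₄ N a d)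
  count₁₄ a d = begin
    ∑ n (λ b → ∑ n (λ c → 𝟙L (a ℕ.* (2 ℕ.* m)) b c (d ℕ.* (2 ℕ.* m))))
      ≡⟨ ∑-cong′ n (λ b → ∑-cong′ n λ c → cong (λ y → 𝟙 (s b ℕ.≟ y)) (ℕ.+-comm c o)) ⟩
    ∑ n (λ b → ∑ n (λ c → 𝟙 (s b ℕ.≟ o ℕ.+ c)))
      ≡⟨ ∑-cong′ n (λ b → count-point n (s b) o) ⟩
    ∑ n (λ b → 𝟙 ((o ℕ.≤? s b) ×-dec (s b ℕ.<? o ℕ.+ n)))
      ≡⟨ ∑-cong′ n (λ b → 𝟙-cong ((o ℕ.≤? s b) ×-dec (s b ℕ.<? o ℕ.+ n)) (window b)
           (halve-≤⇔ (doubled m d) (scaled m a b) ×-⇔ halve-<⇔ (scaled m a b) (doubled-shift m N d))) ⟩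
    ∑ n (λ b → 𝟙 (window b))
      ≡⟨ count-window n (m ℕ.* a) (m ℕ.* (2 ℕ.* d)) (m ℕ.* (2 ℕ.* d) ℕ.+ m ℕ.* N) ⟩
    fromℕ ((((m ℕ.* (2 ℕ.* d) ℕ.+ m ℕ.* N) ∸ m ℕ.* a) ⊓ n) ∸ (m ℕ.* (2 ℕ.* d) ∸ m ℕ.* a))
      ≡⟨ cong fromℕ (trans (cong (λ k → (((m ℕ.* (2 ℕ.* d) ℕ.+ m ℕ.* N) ∸ m ℕ.* a) ⊓ k)
                                          ∸ (m ℕ.* (2 ℕ.* d) ∸ m ℕ.* a)) (n≡m*2N m N))
                           (*-distribˡ-window m (2 ℕ.* d) a N (2 ℕ.* N))) ⟩
    fromℕ (m ℕ.* A₁₄ N a d)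
      ≡⟨ fromℕ-* m (A₁₄ N a d) ⟩
    fromℕ m * fromℕ (A₁₄ N a d) ∎
    where
    open ≡-Reasoning
    o : ℕ
    o = 2 ℕ.* (d ℕ.* (2 ℕ.* m))
    s : ℕ → ℕ
    s b = a ℕ.* (2 ℕ.* m) ℕ.+ 2 ℕ.* b
    window : ∀ b → Dec (m ℕ.* (2 ℕ.* d) ℕ.≤ m ℕ.* a ℕ.+ b × m ℕ.* a ℕ.+ b ℕ.< m ℕ.* (2 ℕ.* d) ℕ.+ m ℕ.* N)
    window b = (m ℕ.* (2 ℕ.* d) ℕ.≤? m ℕ.* a ℕ.+ b) ×-dec (m ℕ.* a ℕ.+ b ℕ.<? m ℕ.* (2 ℕ.* d) ℕ.+ m ℕ.* N)

  module Window₁₂ (S : ℕ) .{{_ : NonZero m}} where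

    private
      X M : ℕ
      X = suc (m ℕ.* S)
      M = m ℕ.* N

    size : ℕ
    size = (X ⊓ n) ∸ (X ∸ M)

    size-high : 2 ℕ.* N ℕ.≤ S → S ℕ.< 3 ℕ.* N → suc size ≡ m ℕ.* (3 ℕ.* N ∸ S)
    size-high 2N≤S S<3N = ℕ.+-cancelʳ-≡ (m ℕ.* S) (suc size) (m ℕ.* (3 ℕ.* N ∸ S)) (begin
      suc size ℕ.+ m ℕ.* S                  ≡⟨ ℕ.+-suc size (m ℕ.* S) ⟨
      size ℕ.+ X                            ≡⟨ cong (size ℕ.+_) (ℕ.m∸n+n≡m M≤X) ⟨
      size ℕ.+ ((X ∸ M) ℕ.+ M)              ≡⟨ ℕ.+-assoc size (X ∸ M) M ⟨
      (size ℕ.+ (X ∸ M)) ℕ.+ M              ≡⟨ cong (λ k → k ℕ.+ (X ∸ M) ℕ.+ M) size≡ ⟩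
      (n ∸ (X ∸ M) ℕ.+ (X ∸ M)) ℕ.+ M       ≡⟨ cong (ℕ._+ M) (ℕ.m∸n+n≡m X∸M≤n) ⟩
      n ℕ.+ M                               ≡⟨ 3M≡n+M m N ⟨
      m ℕ.* (3 ℕ.* N)                       ≡⟨ cong (m ℕ.*_) (ℕ.m∸n+n≡m (ℕ.<⇒≤ S<3N)) ⟨
      m ℕ.* ((3 ℕ.* N ∸ S) ℕ.+ S)           ≡⟨ ℕ.*-distribˡ-+ m (3 ℕ.* N ∸ S) S ⟩
      m ℕ.* (3 ℕ.* N ∸ S) ℕ.+ m ℕ.* S       ∎)
      where
      open ≡-Reasoning
      n≤X : n ℕ.≤ X
      n≤X = ℕ.≤-trans (ℕ.≤-reflexive (n≡m*2N m N)) (ℕ.m≤n⇒m≤1+n (ℕ.*-monoʳ-≤ m 2N≤S))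
      M≤X : M ℕ.≤ X
      M≤X = ℕ.≤-trans (ℕ.≤-trans (ℕ.m≤m+n M M) (ℕ.≤-reflexive (sym (n≡M+M m N)))) n≤X
      X∸M≤n : X ∸ M ℕ.≤ n
      X∸M≤n = ℕ.m≤n+o⇒m∸n≤o X M (ℕ.≤-trans (ℕ.*-monoʳ-< m S<3N)
                                            (ℕ.≤-reflexive (trans (3M≡n+M m N) (ℕ.+-comm n M))))
      size≡ : size ≡ n ∸ (X ∸ M)
      size≡ = cong (_∸ (X ∸ M)) (ℕ.m≥n⇒m⊓n≡n n≤X)

    size-value : S ℕ.< 3 ℕ.* N → fromℕ size ≡ fromℕ m * fromℕ (A₁₂ N S) + B₁₂ N S
    size-value S<3N with S ℕ.<? N | S ℕ.<? 2 ℕ.* N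
    ... | yes S<N | _ = begin
      fromℕ ((X ⊓ n) ∸ (X ∸ M))
        ≡⟨ cong fromℕ (cong₂ _∸_ (ℕ.m≤n⇒m⊓n≡m (ℕ.≤-trans X≤M M≤n)) (ℕ.m≤n⇒m∸n≡0 X≤M)) ⟩
      1ℚ + fromℕ (m ℕ.* S)       ≡⟨ QP.+-comm 1ℚ (fromℕ (m ℕ.* S)) ⟩
      fromℕ (m ℕ.* S) + 1ℚ       ≡⟨ cong (_+ 1ℚ) (fromℕ-* m S) ⟩
      fromℕ m * fromℕ S + 1ℚ     ∎
      where
      open ≡-Reasoning
      X≤M : X ℕ.≤ M
      X≤M = ℕ.*-monoʳ-< m S<N
      M≤n : M ℕ.≤ n
      M≤n = ℕ.≤-trans (ℕ.m≤m+n M M) (ℕ.≤-reflexive (sym (n≡M+M m N)))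
    ... | no S≮N | yes S<2N = begin
      fromℕ ((X ⊓ n) ∸ (X ∸ M))
        ≡⟨ cong fromℕ (trans (cong (_∸ (X ∸ M)) (ℕ.m≤n⇒m⊓n≡m X≤n)) (ℕ.m∸[m∸n]≡n M≤X)) ⟩
      fromℕ M                    ≡⟨ fromℕ-* m N ⟩
      fromℕ m * fromℕ N          ≡⟨ QP.+-identityʳ (fromℕ m * fromℕ N) ⟨
      fromℕ m * fromℕ N + 0ℚ     ∎
      where
      open ≡-Reasoning
      X≤n : X ℕ.≤ n
      X≤n = ℕ.≤-trans (ℕ.*-monoʳ-< m S<2N) (ℕ.≤-reflexive (sym (n≡m*2N m N)))
      M≤X : M ℕ.≤ X
      M≤X = ℕ.m≤n⇒m≤1+n (ℕ.*-monoʳ-≤ m (ℕ.≮⇒≥ S≮N))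
    ... | no _ | no S≮2N = begin
      fromℕ size                             ≡⟨ add-sub (fromℕ size) ⟩
      (1ℚ + fromℕ size) + - 1ℚ               ≡⟨ cong (λ k → fromℕ k + - 1ℚ) (size-high (ℕ.≮⇒≥ S≮2N) S<3N) ⟩
      fromℕ (m ℕ.* (3 ℕ.* N ∸ S)) + - 1ℚ     ≡⟨ cong (_+ - 1ℚ) (fromℕ-* m (3 ℕ.* N ∸ S)) ⟩
      fromℕ m * fromℕ (3 ℕ.* N ∸ S) + - 1ℚ   ∎
      where
      open ≡-Reasoning
      add-sub : ∀ v → v ≡ (1ℚ + v) + - 1ℚ
      add-sub = RingSolver.solve-∀ ℚ-ring

  window₁₂⇔ : ∀ S d → (2 ℕ.* d ℕ.≤ 2 ℕ.* (m ℕ.* S) × 2 ℕ.* (m ℕ.* S) ℕ.< 2 ℕ.* d ℕ.+ n)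
                    ⇔ (suc (m ℕ.* S) ∸ m ℕ.* N ℕ.≤ d × d ℕ.< suc (m ℕ.* S))
  window₁₂⇔ S d = mk⇔
    (λ (p , q) → ℕ.m≤n+o⇒m∸n≤o (suc (m ℕ.* S)) (m ℕ.* N)
                   (subst (suc (m ℕ.* S) ℕ.≤_) (ℕ.+-comm d (m ℕ.* N)) (Equivalence.to halve-< q))
               , s≤s (ℕ.*-cancelˡ-≤ 2 p))
    (λ (r , s) → ℕ.*-monoʳ-≤ 2 (ℕ.s≤s⁻¹ s)
               , Equivalence.from halve-< (ℕ.≤-trans (ℕ.m≤n+m∸n (suc (m ℕ.* S)) (m ℕ.* N))
                                                      (ℕ.≤-trans (ℕ.+-monoʳ-≤ (m ℕ.* N) r)
                                                                 (ℕ.≤-reflexive (ℕ.+-comm (m ℕ.* N) d)))))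
    where
    halve-< : 2 ℕ.* (m ℕ.* S) ℕ.< 2 ℕ.* d ℕ.+ n ⇔ m ℕ.* S ℕ.< d ℕ.+ m ℕ.* N
    halve-< = halve-<⇔ refl (shifted m N d)

  count₁₂ : .{{_ : NonZero m}} → ∀ a b → a ℕ.+ 2 ℕ.* b ℕ.< 3 ℕ.* N →
    ∑ n (λ c → ∑ n (λ d → 𝟙L (a ℕ.* (2 ℕ.* m)) (b ℕ.* (2 ℕ.* m)) c d))
    ≡ fromℕ m * fromℕ (A₁₂ N (a ℕ.+ 2 ℕ.* b)) + B₁₂ N (a ℕ.+ 2 ℕ.* b)
  count₁₂ a b S<3N = begin
    ∑ n (λ c → ∑ n (λ d → 𝟙L (a ℕ.* (2 ℕ.* m)) (b ℕ.* (2 ℕ.* m)) c d))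
      ≡⟨ ∑-swap n n (λ c d → 𝟙L (a ℕ.* (2 ℕ.* m)) (b ℕ.* (2 ℕ.* m)) c d) ⟩
    ∑ n (λ d → ∑ n (λ c → 𝟙L (a ℕ.* (2 ℕ.* m)) (b ℕ.* (2 ℕ.* m)) c d))
      ≡⟨ ∑-cong′ n (λ d → ∑-cong′ n λ c →
           cong₂ (λ x y → 𝟙 (x ℕ.≟ y)) (scaled-S m a b) (ℕ.+-comm c (2 ℕ.* d))) ⟩
    ∑ n (λ d → ∑ n (λ c → 𝟙 (2 ℕ.* (m ℕ.* S) ℕ.≟ 2 ℕ.* d ℕ.+ c)))
      ≡⟨ ∑-cong′ n (λ d → count-point n (2 ℕ.* (m ℕ.* S)) (2 ℕ.* d)) ⟩
    ∑ n (λ d → 𝟙 ((2 ℕ.* d ℕ.≤? 2 ℕ.* (m ℕ.* S)) ×-dec (2 ℕ.* (m ℕ.* S) ℕ.<? 2 ℕ.* d ℕ.+ n)))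
      ≡⟨ ∑-cong′ n (λ d → 𝟙-cong ((2 ℕ.* d ℕ.≤? 2 ℕ.* (m ℕ.* S)) ×-dec (2 ℕ.* (m ℕ.* S) ℕ.<? 2 ℕ.* d ℕ.+ n))
                                  (window d) (window₁₂⇔ S d)) ⟩
    ∑ n (λ d → 𝟙 (window d))
      ≡⟨ count-window n 0 (suc (m ℕ.* S) ∸ m ℕ.* N) (suc (m ℕ.* S)) ⟩
    fromℕ (Window₁₂.size S)
      ≡⟨ Window₁₂.size-value S S<3N ⟩
    fromℕ m * fromℕ (A₁₂ N S) + B₁₂ N S ∎
    where
    open ≡-Reasoning
    S : ℕ
    S = a ℕ.+ 2 ℕ.* b
    window : ∀ d → Dec (suc (m ℕ.* S) ∸ m ℕ.* N ℕ.≤ d × d ℕ.< suc (m ℕ.* S))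
    window d = (suc (m ℕ.* S) ∸ m ℕ.* N ℕ.≤? d) ×-dec (d ℕ.<? suc (m ℕ.* S))

α₁₂ β₁₂ α₁₃ α₁₄ α₂₄ α β : ℕ → (ℕ → ℚ) → ℚ
α₁₂ N h = quadForm N (λ a b → fromℕ (A₁₂ N (a ℕ.+ 2 ℕ.* b))) h
β₁₂ N h = quadForm N (λ a b → B₁₂ N (a ℕ.+ 2 ℕ.* b)) h
α₁₃ N h = quadForm N (λ a c → fromℕ (A₁₃ N a c)) h
α₁₄ N h = quadForm N (λ a d → fromℕ (A₁₄ N a d)) h
α₂₄ N h = quadForm N (λ b d → fromℕ (A₂₄ N b d)) h
α N h = 2ℚ * α₁₂ N h + α₁₃ N h + 2ℚ * α₁₄ N h + α₂₄ N h
β N h = 2ℚ * β₁₂ N h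

module SpikeFunction (N : ℕ) (h : ℕ → ℚ) (m : ℕ) .{{_ : NonZero m}} where

  K n : ℕ
  K = 2 ℕ.* m
  n = N ℕ.* K

  instance
    K≢0 : NonZero K
    K≢0 = ℕ.m*n≢0 2 m

  g f : ℕ → ℚ
  g = spike K h
  f y = ½ + g y

  open PairCounts m N using (count₁₂; count₁₃; count₁₄; count₂₄)

  pairSum₁₂ : ∑⁴[ 𝟙L ] n (λ a b _ _ → g a * g b) ≡ fromℕ m * α₁₂ N h + β₁₂ N h
  pairSum₁₂ = begin
    ∑⁴[ 𝟙L ] n (λ a b _ _ → g a * g b)
      ≡⟨ ∑⁴-pair₁₂ n 𝟙L g ⟩
    quadForm n (λ a b → ∑ n λ c → ∑ n (𝟙L a b c)) g
      ≡⟨ quadForm-spike K h N (λ a b → ∑ n λ c → ∑ n (𝟙L a b c)) ⟩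
    quadForm N (λ a b → ∑ n λ c → ∑ n (𝟙L (a ℕ.* K) (b ℕ.* K) c)) h
      ≡⟨ quadForm-cong N h (λ a b a<N b<N → count₁₂ a b (ℕ.+-mono-<-≤ a<N (ℕ.*-monoʳ-≤ 2 (ℕ.<⇒≤ b<N)))) ⟩
    quadForm N (λ a b → fromℕ m * fromℕ (A₁₂ N (a ℕ.+ 2 ℕ.* b)) + B₁₂ N (a ℕ.+ 2 ℕ.* b)) h
      ≡⟨ quadForm-+ N (λ a b → fromℕ m * fromℕ (A₁₂ N (a ℕ.+ 2 ℕ.* b))) (λ a b → B₁₂ N (a ℕ.+ 2 ℕ.* b)) h ⟩
    quadForm N (λ a b → fromℕ m * fromℕ (A₁₂ N (a ℕ.+ 2 ℕ.* b))) h + β₁₂ N h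
      ≡⟨ cong (_+ β₁₂ N h) (quadForm-*ˡ N (fromℕ m) (λ a b → fromℕ (A₁₂ N (a ℕ.+ 2 ℕ.* b))) h) ⟩
    fromℕ m * α₁₂ N h + β₁₂ N h ∎
    where open ≡-Reasoning

  pairSum₁₃ : ∑⁴[ 𝟙L ] n (λ a _ c _ → g a * g c) ≡ fromℕ m * α₁₃ N h
  pairSum₁₃ = begin
    ∑⁴[ 𝟙L ] n (λ a _ c _ → g a * g c)
      ≡⟨ ∑⁴-pair₁₃ n 𝟙L g ⟩
    quadForm n (λ a c → ∑ n λ b → ∑ n (𝟙L a b c)) g
      ≡⟨ quadForm-spike K h N (λ a c → ∑ n λ b → ∑ n (𝟙L a b c)) ⟩
    quadForm N (λ a c → ∑ n λ b → ∑ n (𝟙L (a ℕ.* K) b (c ℕ.* K))) h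
      ≡⟨ quadForm-cong N h (λ a c _ _ → count₁₃ a c) ⟩
    quadForm N (λ a c → fromℕ m * fromℕ (A₁₃ N a c)) h
      ≡⟨ quadForm-*ˡ N (fromℕ m) (λ a c → fromℕ (A₁₃ N a c)) h ⟩
    fromℕ m * α₁₃ N h ∎
    where open ≡-Reasoning

  pairSum₁₄ : ∑⁴[ 𝟙L ] n (λ a _ _ d → g a * g d) ≡ fromℕ m * α₁₄ N h
  pairSum₁₄ = begin
    ∑⁴[ 𝟙L ] n (λ a _ _ d → g a * g d)
      ≡⟨ ∑⁴-pair₁₄ n 𝟙L g ⟩
    quadForm n (λ a d → ∑ n λ b → ∑ n λ c → 𝟙L a b c d) g
      ≡⟨ quadForm-spike K h N (λ a d → ∑ n λ b → ∑ n λ c → 𝟙L a b c d) ⟩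
    quadForm N (λ a d → ∑ n λ b → ∑ n λ c → 𝟙L (a ℕ.* K) b c (d ℕ.* K)) h
      ≡⟨ quadForm-cong N h (λ a d _ _ → count₁₄ a d) ⟩
    quadForm N (λ a d → fromℕ m * fromℕ (A₁₄ N a d)) h
      ≡⟨ quadForm-*ˡ N (fromℕ m) (λ a d → fromℕ (A₁₄ N a d)) h ⟩
    fromℕ m * α₁₄ N h ∎
    where open ≡-Reasoning

  pairSum₂₄ : ∑⁴[ 𝟙L ] n (λ _ b _ d → g b * g d) ≡ fromℕ m * α₂₄ N h
  pairSum₂₄ = begin
    ∑⁴[ 𝟙L ] n (λ _ b _ d → g b * g d)
      ≡⟨ ∑⁴-pair₂₄ n 𝟙L g ⟩
    quadForm n (λ b d → ∑ n λ a → ∑ n λ c → 𝟙L a b c d) g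
      ≡⟨ quadForm-spike K h N (λ b d → ∑ n λ a → ∑ n λ c → 𝟙L a b c d) ⟩
    quadForm N (λ b d → ∑ n λ a → ∑ n λ c → 𝟙L a (b ℕ.* K) c (d ℕ.* K)) h
      ≡⟨ quadForm-cong N h (λ b d _ _ → count₂₄ b d) ⟩
    quadForm N (λ b d → fromℕ m * fromℕ (A₂₄ N b d)) h
      ≡⟨ quadForm-*ˡ N (fromℕ m) (λ b d → fromℕ (A₂₄ N b d)) h ⟩
    fromℕ m * α₂₄ N h ∎
    where open ≡-Reasoning

  pairSum₃₄ : ∑⁴[ 𝟙L ] n (λ _ _ c d → g c * g d) ≡ fromℕ m * α₁₂ N h + β₁₂ N h
  pairSum₃₄ = trans (∑⁴[𝟙L]-swap-pairs n (λ _ _ c d → g c * g d)) pairSum₁₂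

  pairSum₂₃ : ∑⁴[ 𝟙L ] n (λ _ b c _ → g b * g c) ≡ fromℕ m * α₁₄ N h
  pairSum₂₃ = trans (∑⁴[𝟙L]-swap-pairs n (λ _ b c _ → g b * g c))
    (trans (∑⁴-cong n λ a b c d → cong (𝟙L a b c d *_) (QP.*-comm (g d) (g a))) pairSum₁₄)

  pairSums : ∑⁴[ 𝟙L ] n (λ a b _ _ → g a * g b) + ∑⁴[ 𝟙L ] n (λ a _ c _ → g a * g c)
             + ∑⁴[ 𝟙L ] n (λ a _ _ d → g a * g d) + ∑⁴[ 𝟙L ] n (λ _ b c _ → g b * g c)
             + ∑⁴[ 𝟙L ] n (λ _ b _ d → g b * g d) + ∑⁴[ 𝟙L ] n (λ _ _ c d → g c * g d)
             ≡ fromℕ m * α N h + β N h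
  pairSums = trans
    (cong₂ _+_ (cong₂ _+_ (cong₂ _+_ (cong₂ _+_ (cong₂ _+_ pairSum₁₂ pairSum₁₃) pairSum₁₄) pairSum₂₃)
                          pairSum₂₄)
               pairSum₃₄)
    (collect (fromℕ m) (α₁₂ N h) (β₁₂ N h) (α₁₃ N h) (α₁₄ N h) (α₂₄ N h))
    where
    collect : ∀ x a₁₂ b₁₂ a₁₃ a₁₄ a₂₄ →
      (x * a₁₂ + b₁₂) + x * a₁₃ + x * a₁₄ + x * a₁₄ + x * a₂₄ + (x * a₁₂ + b₁₂)
      ≡ x * (2ℚ * a₁₂ + a₁₃ + 2ℚ * a₁₄ + a₂₄) + 2ℚ * b₁₂
    collect = RingSolver.solve-∀ ℚ-ring

  𝟙L-spikes : ℕ → ℕ → ℕ → ℕ → ℚ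
  𝟙L-spikes a b c d = 𝟙L (a ℕ.* K) (b ℕ.* K) (c ℕ.* K) (d ℕ.* K)

  Q : ℚ
  Q = quarticForm N 𝟙L-spikes h

  ∣Q∣-≤ : ∀ {ω} → (∀ a → ∣ h a ∣ ≤ ω) →
    ∣ Q ∣ ≤ fromℕ N * (ω * (fromℕ N * (ω * (fromℕ N * (ω * (fromℕ N * (ω * 1ℚ)))))))
  ∣Q∣-≤ = quarticForm-bound N 𝟙L-spikes h λ a b c d →
    ∣𝟙∣≤1 (a ℕ.* K ℕ.+ 2 ℕ.* (b ℕ.* K) ℕ.≟ c ℕ.* K ℕ.+ 2 ℕ.* (d ℕ.* K))

  T-spike : T L n (f ∘ toℕ) + T L n (λ i → 1ℚ - f (toℕ i))
            ≡ ⅛ * T L n one + (½ * (fromℕ m * α N h + β N h) + 2ℚ * Q)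
  T-spike = begin
    T L n (f ∘ toℕ) + T L n ((λ y → 1ℚ - f y) ∘ toℕ)
      ≡⟨ cong₂ _+_ (T-L n f) (T-L n (λ y → 1ℚ - f y)) ⟩
    ∑⁴[ 𝟙L ] n (Π⁴ f) + ∑⁴[ 𝟙L ] n (Π⁴ (λ y → 1ℚ - f y))
      ≡⟨ expand-½ n 𝟙L g ⟩
    ⅛ * ∑⁴[ 𝟙L ] n (Π⁴ (λ _ → 1ℚ))
    + (½ * (∑⁴[ 𝟙L ] n (λ a b _ _ → g a * g b) + ∑⁴[ 𝟙L ] n (λ a _ c _ → g a * g c)
            + ∑⁴[ 𝟙L ] n (λ a _ _ d → g a * g d) + ∑⁴[ 𝟙L ] n (λ _ b c _ → g b * g c)
            + ∑⁴[ 𝟙L ] n (λ _ b _ d → g b * g d) + ∑⁴[ 𝟙L ] n (λ _ _ c d → g c * g d))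
       + 2ℚ * ∑⁴[ 𝟙L ] n (λ a b c d → g a * (g b * (g c * g d))))
      ≡⟨ cong₂ (λ x y → ⅛ * x + y) (sym (T-L n (λ _ → 1ℚ)))
               (cong₂ (λ x y → ½ * x + 2ℚ * y) pairSums
                      (trans (∑⁴-quartic n 𝟙L g) (quarticForm-spike K h N 𝟙L))) ⟩
    ⅛ * T L n one + (½ * (fromℕ m * α N h + β N h) + 2ℚ * Q) ∎
    where open ≡-Reasoning

safeDiv-+-< : ∀ {c x y z e} → 0ℚ < c → 0ℚ ≤ z → e < 0ℚ → x + y ≡ c * z + e →
  safeDiv x z + safeDiv y z < c
safeDiv-+-< {c} {x} {y} {z} {e} 0<c 0≤z e<0 x+y≡ with z QP.≟ 0ℚ
... | yes _   = subst (_< c) (sym (QP.+-identityˡ 0ℚ)) 0<c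
... | no z≢0  = begin-strict
  x * z⁻¹ + y * z⁻¹          ≡⟨ QP.*-distribʳ-+ z⁻¹ x y ⟨
  (x + y) * z⁻¹              ≡⟨ cong (_* z⁻¹) x+y≡ ⟩
  (c * z + e) * z⁻¹          ≡⟨ expand c z e z⁻¹ ⟩
  c * (z * z⁻¹) + e * z⁻¹    ≡⟨ cong (λ u → c * u + e * z⁻¹) (QP.*-inverseʳ z {{nz}}) ⟩
  c * 1ℚ + e * z⁻¹           <⟨ QP.+-monoʳ-< (c * 1ℚ) (subst (e * z⁻¹ <_) (QP.*-zeroˡ z⁻¹)
                                                       (QP.*-monoˡ-<-pos z⁻¹ {{z⁻¹>0}} e<0)) ⟩
  c * 1ℚ + 0ℚ                ≡⟨ trans (QP.+-identityʳ (c * 1ℚ)) (QP.*-identityʳ c) ⟩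
  c                          ∎
  where
  open QP.≤-Reasoning
  nz : ℚ.NonZero z
  nz = ℚ.≢-nonZero z≢0
  z⁻¹ : ℚ
  z⁻¹ = (1/ z) {{nz}}
  z>0 : 0ℚ < z
  z>0 with 0ℚ QP.<? z
  ... | yes 0<z = 0<z
  ... | no 0≮z  = contradiction (QP.≤-antisym (QP.≮⇒≥ 0≮z) 0≤z) z≢0
  z⁻¹>0 : ℚ.Positive z⁻¹
  z⁻¹>0 = QP.1/pos⇒pos z {{ℚ.positive z>0}}
  expand : ∀ c z e w → (c * z + e) * w ≡ c * (z * w) + e * w
  expand = RingSolver.solve-∀ ℚ-ring

-- The counterexample

_‼_ : List ℚ → ℕ → ℚ
[]       ‼ _     = 0ℚ
(x ∷ xs) ‼ zero  = x
(x ∷ xs) ‼ suc a = xs ‼ a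

‼-All : (P : ℚ → Set) → P 0ℚ → ∀ {xs} → All P xs → ∀ a → P (xs ‼ a)
‼-All P P0 []        a       = P0
‼-All P P0 (Px ∷ _)  zero    = Px
‼-All P P0 (_ ∷ Pxs) (suc a) = ‼-All P P0 Pxs a

-- With these heights f = ½ + spike K h₀ takes the value c/36 at the a-th spike.
spikeHeights : List ℚ
spikeHeights = map (λ c → ℤ.+ c ℚ./ 36 - ½)
  (17 ∷ 26 ∷ 4 ∷ 11 ∷ 36 ∷ 15 ∷ 33 ∷ 11 ∷ 1 ∷ 26 ∷ 17 ∷ 26 ∷ 1 ∷ 11 ∷ 33 ∷ 15 ∷ 36 ∷ 11 ∷ 4 ∷ 25 ∷ [])

h₀ : ℕ → ℚ
h₀ = spikeHeights ‼_

∣h₀∣≤½ : ∀ a → ∣ h₀ a ∣ ≤ ½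
∣h₀∣≤½ = ‼-All (λ v → ∣ v ∣ ≤ ½) (toWitness {a? = ∣ 0ℚ ∣ QP.≤? ½} _)
  (toWitness {a? = all? (λ v → ∣ v ∣ QP.≤? ½) spikeHeights} _)

½+h₀∈[0,1] : ∀ a → 0ℚ ≤ ½ + h₀ a × ½ + h₀ a ≤ 1ℚ
½+h₀∈[0,1] = ‼-All (λ v → 0ℚ ≤ ½ + v × ½ + v ≤ 1ℚ)
  (toWitness {a? = (0ℚ QP.≤? ½ + 0ℚ) ×-dec (½ + 0ℚ QP.≤? 1ℚ)} _)
  (toWitness {a? = all? (λ v → (0ℚ QP.≤? ½ + v) ×-dec (½ + v QP.≤? 1ℚ)) spikeHeights} _)

α₀≤0 : α 20 h₀ ≤ 0ℚ
α₀≤0 = toWitness {a? = α 20 h₀ QP.≤? 0ℚ} _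

quarticBound₀ : ℚ
quarticBound₀ = fromℕ 20 * (½ * (fromℕ 20 * (½ * (fromℕ 20 * (½ * (fromℕ 20 * (½ * 1ℚ)))))))

excess₀<0 : ½ * (fromℕ 400 * fromℕ 400 * α 20 h₀ + β 20 h₀) + 2ℚ * quarticBound₀ < 0ℚ
excess₀<0 = toWitness {a? = ½ * (fromℕ 400 * fromℕ 400 * α 20 h₀ + β 20 h₀) + 2ℚ * quarticBound₀ QP.<? 0ℚ} _

-- Opaque so that the type checker never unfolds fromℕ m₀, a sum of 160000 ones.
opaque
  m₀ : ℕ
  m₀ = 400 ℕ.* 400

  fromℕ-m₀ : fromℕ m₀ ≡ fromℕ 400 * fromℕ 400
  fromℕ-m₀ = fromℕ-* 400 400

module Counterexample (p : ℕ) where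

  open SpikeFunction 20 h₀ (suc p) public using (n; f)
  open SpikeFunction 20 h₀ (suc p) using (K; Q; ∣Q∣-≤; T-spike)

  f∈[0,1] : ∀ y → 0ℚ ≤ f y × f y ≤ 1ℚ
  f∈[0,1] = spike-preserves K h₀ (λ v → 0ℚ ≤ ½ + v × ½ + v ≤ 1ℚ)
    (toWitness {a? = (0ℚ QP.≤? ½ + 0ℚ) ×-dec (½ + 0ℚ QP.≤? 1ℚ)} _) ½+h₀∈[0,1]

  excess<0 : m₀ ℕ.≤ suc p → ½ * (fromℕ (suc p) * α 20 h₀ + β 20 h₀) + 2ℚ * Q < 0ℚ
  excess<0 m₀≤m = QP.≤-<-trans (QP.+-mono-≤ pairs≤ quartic≤)
    (subst (λ x → ½ * (x * α 20 h₀ + β 20 h₀) + 2ℚ * quarticBound₀ < 0ℚ) (sym fromℕ-m₀) excess₀<0)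
    where
    pairs≤ : ½ * (fromℕ (suc p) * α 20 h₀ + β 20 h₀) ≤ ½ * (fromℕ m₀ * α 20 h₀ + β 20 h₀)
    pairs≤ = QP.*-monoˡ-≤-nonNeg ½ (QP.+-monoˡ-≤ (β 20 h₀)
               (QP.*-monoʳ-≤-nonPos (α 20 h₀) {{ℚ.nonPositive α₀≤0}} (fromℕ-mono-≤ m₀≤m)))
    quartic≤ : 2ℚ * Q ≤ 2ℚ * quarticBound₀
    quartic≤ = QP.*-monoˡ-≤-nonNeg 2ℚ (QP.≤-trans (p≤∣p∣ Q) (∣Q∣-≤ ∣h₀∣≤½))

  t-sum<⅛ : m₀ ℕ.≤ suc p → t L n (f ∘ toℕ) + t L n (λ i → 1ℚ - f (toℕ i)) < twoPow1-k 4
  t-sum<⅛ m₀≤m = safeDiv-+-< {⅛} {T L n (f ∘ toℕ)} {T L n (λ i → 1ℚ - f (toℕ i))} {T L n one}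
    (toWitness {a? = 0ℚ QP.<? ⅛} _) (T-L-one-nonneg n) (excess<0 m₀≤m) T-spike

theorem1p1 : Uncommon L
theorem1p1 (N , common) = QP.<-irrefl refl (QP.≤-<-trans
  (common n N≤n (f ∘ toℕ) (proj₁ ∘ f∈[0,1] ∘ toℕ) (proj₂ ∘ f∈[0,1] ∘ toℕ))
  (t-sum<⅛ (ℕ.m≤n⇒m≤1+n (ℕ.m≤n+m m₀ N))))
  where
  open Counterexample (N ℕ.+ m₀)
  N≤n : N ℕ.≤ n
  N≤n = ℕ.≤-trans (ℕ.m≤n⇒m≤1+n (ℕ.m≤m+n N m₀))
          (ℕ.≤-trans (ℕ.m≤n*m (suc (N ℕ.+ m₀)) 2) (ℕ.m≤n*m (2 ℕ.* suc (N ℕ.+ m₀)) 20))
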